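{- Let $P$ be a finite poset with connected components $P_1,\dots,P_r$, and let $q>2$ be a prime power. Then the minimum distance of the toric code of the order polytope over $\mathbb{F}_q$ satisfies \[ d(\mathcal{C}_{\mathbf{O}_P})=d(\mathcal{C}_{\mathbf{O}_{P_1}})\cdots d(\mathcal{C}_{\mathbf{O}_{P_r}}). \]
   Context: For a finite poset $P=\{\varepsilon_1,\dots,\varepsilon_m\}$, an upper order ideal is a subset $I$ with $y\in I,\ y\le x\Rightarrow x\in I$; the order polytope $\mathbf{O}_P\subset\mathbb{Q}^m$ is the convex hull of the $0/1$ indicator vectors (coordinates indexed by elements of $P$) of the upper order ideals of $P$. Connected components of $P$ are the subposets on the connected components of its Hasse diagram. Toric codes: for a full-dimensional lattice polytope $\mathbf{P}\subset\mathbb{Q}^n$, let $L_{\mathbf{P}}$ be the $\mathbb{F}_q$-span of the Laurent monomials $x^u$, $u\in\mathbf{P}\cap\mathbb{Z}^n$; the toric code $\mathcal{C}_{\mathbf{P}}$ is the image of $f\mapsto(f(t))_{t\in(\mathbb{F}_q^*)^n}$. With $Z(f)$ the number of zeros of $f$ in $(\mathbb{F}_q^*)^n$, the minimum distance is $d(\mathcal{C}_{\mathbf{P}})=(q-1)^n-\max_{0\neq f\in L_{\mathbf{P}}}Z(f)$. -}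

module Defs where

open import Level using (Level; _⊔_) renaming (suc to lsuc; zero to 0ℓ)
open import Data.Nat as ℕ using (ℕ; zero; suc; _∸_; _^_)
open import Data.Integer as ℤ using (ℤ; +_; -[1+_])
open import Data.Rational as ℚ using (ℚ; 0ℚ; 1ℚ)
open import Data.Fin using (Fin)
open import Data.Fin.Properties using (all?)
open import Data.Fin.Subset using (Subset; _∈_)
open import Data.Fin.Subset.Properties using (_∈?_)
open import Data.List using (List; []; _∷_; foldr; length; filter; map; concatMap)
open import Data.List.Relation.Unary.All using (All)
open import Data.List.Relation.Unary.Any using (Any)
open import Data.List.Relation.Unary.AllPairs using (AllPairs)
open import Data.Product using (Σ; ∃; _×_; _,_; proj₁; proj₂)
open import Data.Sum using (_⊎_)
open import Relation.Nullary using (¬_; Dec; yes; no)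
open import Relation.Binary using (Rel; IsPartialOrder)
open import Relation.Binary.PropositionalEquality using (_≡_; _≢_)
open import Relation.Binary.Construct.Closure.ReflexiveTransitive using (Star)
open import Relation.Binary.Construct.Closure.Symmetric using (SymClosure)
open import Function.Bundles using (_↔_; _⇔_; Inverse)
open import Algebra.Bundles using (CommutativeRing)

record FiniteField (c ℓ : Level) : Set (lsuc (c ⊔ ℓ)) where
  field
    commRing : CommutativeRing c ℓ
  open CommutativeRing commRing public hiding (ring)
  field
    _≟_       : (x y : Carrier) → Dec (x ≈ y)
    1≉0       : ¬ (1# ≈ 0#)
    _⁻¹       : Carrier → Carrier
    inverseʳ  : ∀ x → ¬ (x ≈ 0#) → x * (x ⁻¹) ≈ 1#
    elements  : List Carrier
    complete  : ∀ x → Any (x ≈_) elements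
    distinct  : AllPairs (λ x y → ¬ (x ≈ y)) elements

  size : ℕ
  size = length elements

ℚ^ : ℕ → Set
ℚ^ n = Fin n → ℚ

ℤ^ : ℕ → Set
ℤ^ n = Fin n → ℤ

toℚ^ : ∀ {n} → ℤ^ n → ℚ^ n
toℚ^ u i = u i ℚ./ 1

sumℚ : List ℚ → ℚ
sumℚ = foldr ℚ._+_ 0ℚ

InConvexHull : ∀ {n} → (ℚ^ n → Set) → ℚ^ n → Set
InConvexHull {n} S u =
  Σ (List (ℚ × ℚ^ n)) λ comb →
      All (λ p → ℚ._≤_ 0ℚ (proj₁ p) × S (proj₂ p)) comb
    × sumℚ (map proj₁ comb) ≡ 1ℚ
    × (∀ i → sumℚ (map (λ p → proj₁ p ℚ.* proj₂ p i) comb) ≡ u i)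

LatticePoint : ∀ {n} → (ℚ^ n → Set) → ℤ^ n → Set
LatticePoint S u = InConvexHull S (toℚ^ u)

_≟ᵛ_ : ∀ {n} (u v : ℤ^ n) → Dec (∀ i → u i ≡ v i)
u ≟ᵛ v = all? (λ i → u i ℤ.≟ v i)

module Toric {c ℓ} (F : FiniteField c ℓ) where
  open FiniteField F

  -- integer powers (Laurent monomials); only used at nonzero points
  powF : Carrier → ℕ → Carrier
  powF x zero    = 1#
  powF x (suc k) = x * powF x k

  _^ℤ_ : Carrier → ℤ → Carrier
  x ^ℤ (+ k)      = powF x k
  x ^ℤ (-[1+ k ]) = powF (x ⁻¹) (suc k)

  prodF : ∀ {n} → (Fin n → Carrier) → Carrier
  prodF {zero}  f = 1#
  prodF {suc n} f = f Fin.zero * prodF (λ i → f (Fin.suc i))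
    where import Data.Fin as Fin

  LaurentPoly : ℕ → Set c
  LaurentPoly n = List (Carrier × ℤ^ n)

  -- coefficient of x^v in f (after collecting equal monomials)
  coeff : ∀ {n} → LaurentPoly n → ℤ^ n → Carrier
  coeff [] v = 0#
  coeff ((a , u) ∷ f) v with u ≟ᵛ v
  ... | yes _ = a + coeff f v
  ... | no  _ = coeff f v

  NonZeroPoly : ∀ {n} → LaurentPoly n → Set ℓ
  NonZeroPoly {n} f = Σ (ℤ^ n) λ v → ¬ (coeff f v ≈ 0#)

  InL : ∀ {n} → (ℚ^ n → Set) → LaurentPoly n → Set c
  InL S f = All (λ t → LatticePoint S (proj₂ t)) f

  monomial : ∀ {n} → ℤ^ n → (Fin n → Carrier) → Carrier
  monomial u t = prodF (λ i → t i ^ℤ u i)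

  eval : ∀ {n} → LaurentPoly n → (Fin n → Carrier) → Carrier
  eval f t = foldr (λ p acc → proj₁ p * monomial (proj₂ p) t + acc) 0# f

  nonzeroElements : List Carrier
  nonzeroElements = filter (λ x → Relation.Nullary.¬? (x ≟ 0#)) elements
    where import Relation.Nullary

  torus : (n : ℕ) → List (Fin n → Carrier)
  torus zero    = (λ ()) ∷ []
  torus (suc n) = concatMap (λ x → map (λ t → cons x t) (torus n)) nonzeroElements
    where
      cons : Carrier → (Fin n → Carrier) → Fin (suc n) → Carrier
      cons x t Fin.zero    = x
      cons x t (Fin.suc i) = t i
        where import Data.Fin as Fin

  Z : ∀ {n} → LaurentPoly n → ℕ
  Z {n} f = length (filter (λ t → eval f t ≟ 0#) (torus n))

  IsMaxZeros : ∀ {n} → (ℚ^ n → Set) → ℕ → Set (c ⊔ ℓ)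
  IsMaxZeros {n} S z =
      (Σ (LaurentPoly n) λ f → InL S f × NonZeroPoly f × Z f ≡ z)
    × (∀ (f : LaurentPoly n) → InL S f → NonZeroPoly f → Z f ℕ.≤ z)

  MinDistance : ∀ {n} → (ℚ^ n → Set) → ℕ → Set (c ⊔ ℓ)
  MinDistance {n} S d = Σ ℕ λ z → IsMaxZeros S z × d ≡ (size ∸ 1) ^ n ∸ z

record FinPoset (m : ℕ) : Set₁ where
  field
    _≼_            : Rel (Fin m) 0ℓ
    isPartialOrder : IsPartialOrder _≡_ _≼_

module _ {m : ℕ} (P : FinPoset m) where
  open FinPoset P

  IsUpperIdeal : Subset m → Set
  IsUpperIdeal I = ∀ x y → y ∈ I → y ≼ x → x ∈ I

  indicator : Subset m → ℚ^ m
  indicator I i with i ∈? I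
  ... | yes _ = 1ℚ
  ... | no  _ = 0ℚ

  -- the set of indicator vectors of upper order ideals;
  -- the order polytope O_P is its convex hull
  OrderPolytopeGenerators : ℚ^ m → Set
  OrderPolytopeGenerators v = Σ (Subset m) λ I → IsUpperIdeal I × (∀ i → v i ≡ indicator I i)

  _⋖_ : Rel (Fin m) 0ℓ
  x ⋖ y = x ≼ y × x ≢ y × (∀ z → x ≼ z → z ≼ y → z ≡ x ⊎ z ≡ y)

  Connected : Set
  Connected = Fin m × (∀ x y → Star (SymClosure _⋖_) x y)

module _ {r : ℕ} {ms : Fin r → ℕ} (Q : (i : Fin r) → FinPoset (ms i)) where
  data _≼⊎_ : Rel (Σ (Fin r) (λ i → Fin (ms i))) 0ℓ where
    inj : ∀ {i a b} → FinPoset._≼_ (Q i) a b → (i , a) ≼⊎ (i , b)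

  -- P ≅ Q₁ ⊔ ... ⊔ Qᵣ with each Qᵢ connected, i.e. Q₁,…,Qᵣ are
  -- (up to isomorphism) the connected components of P
  record ComponentDecomposition {m : ℕ} (P : FinPoset m) : Set where
    field
      components-connected : ∀ i → Connected (Q i)
      iso   : Fin m ↔ Σ (Fin r) (λ i → Fin (ms i))
      order : ∀ x y → FinPoset._≼_ P x y ⇔ (Inverse.to iso x ≼⊎ Inverse.to iso y)

-- The minimum distance of C_P is the least Hamming weight, weight f = (q-1)ⁿ - Z(f), of a nonzero f ∈ L_P.
-- A lattice point in the convex hull of 0/1 vectors is one of those vectors, so the lattice points of O_P
-- are the indicator vectors of upper ideals. An upper ideal of P is a tuple of upper ideals of its
-- components, so after a renaming of the variables the exponents of L_P form the product of the exponent
-- sets of the L_{P_k}. Minimum weight is multiplicative over such products: the product g·h of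
-- minimum-weight polynomials in disjoint sets of variables has weight weight(g)·weight(h); conversely,
-- writing f = Σ_v g_v(x) y^v with some g_v ≠ 0, at each of the ≥ d₁ points x where g_v(x) ≠ 0 the slice
-- f(x, ·) is a nonzero polynomial of the second code, so it has ≥ d₂ nonzeros.

module Submission where

open import Defs
open import Data.Nat using (ℕ; _<_; _^_; suc)
open import Data.Nat.Primality using (Prime)
open import Data.Fin using (Fin)
open import Data.List using (tabulate)
open import Data.Nat.ListAction using (product)
open import Data.Product using (Σ; _×_)
open import Relation.Binary.PropositionalEquality using (_≡_)

open import Level using (Level)
import Data.Nat as ℕ
import Data.Nat.Properties as ℕP
open import Data.List using (List; []; _∷_; _++_; map; concatMap; length; filter)
open import Data.List.Relation.Unary.All as All using (All; []; _∷_)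
open import Data.List.Relation.Unary.All.Properties using (map⁺; concat⁺)
open import Data.List.Relation.Unary.Any using (Any; here; there)
open import Data.List.Relation.Unary.AllPairs using (AllPairs; []; _∷_)
open import Data.Product using (_,_; proj₁; proj₂)
open import Data.Empty using (⊥-elim)
open import Data.Unit using (⊤; tt)
open import Function using (_∘_)
open import Data.Fin using (zero; suc; splitAt; join; _↑ˡ_; _↑ʳ_)
open import Data.Fin.Properties using (join-splitAt; splitAt-↑ˡ; splitAt-↑ʳ; splitAt⁻¹-↑ˡ; splitAt⁻¹-↑ʳ)
open import Data.Sum using (_⊎_; inj₁; inj₂; [_,_])
open import Data.Vec.Functional using (Vector; insertAt; take; drop)
  renaming (_∷_ to _∷ᵛ_; _++_ to _++ᵛ_)
open import Data.Vec.Functional.Properties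
  using (++-cong; ++-injectiveˡ; ++-injectiveʳ; lookup-++ˡ; lookup-++ʳ; insertAt-lookup; insertAt-punchIn)
open import Function.Definitions using (Congruent)
open import Relation.Binary.Definitions using (_Respects_)
open import Function.Properties.Inverse using (↔-trans; ↔-sym)
open import Relation.Nullary using (¬_; Dec; yes; no; ¬?)
open import Relation.Binary.PropositionalEquality as ≡ using (refl; cong; cong₂; _≗_)
import Relation.Binary.Reasoning.Setoid

private variable
  a b : Level
  A : Set a
  B : Set b

∷-cong : ∀ {n} (z : A) {s t : Vector A n} → s ≗ t → z ∷ᵛ s ≗ z ∷ᵛ t
∷-cong z s≗t zero    = refl
∷-cong z s≗t (suc i) = s≗t i

∷-++ : ∀ {m n} (z : A) (s : Vector A m) (t : Vector A n) → z ∷ᵛ (s ++ᵛ t) ≗ (z ∷ᵛ s) ++ᵛ t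
∷-++ z s t zero    = refl
∷-++ {m = m} z s t (suc i) with splitAt m i
... | inj₁ _ = refl
... | inj₂ _ = refl

insertAt-cong : ∀ {n} {s t : Vector A n} (j : Fin (suc n)) (z : A) → s ≗ t → insertAt s j z ≗ insertAt t j z
insertAt-cong               zero    z s≗t zero    = refl
insertAt-cong               zero    z s≗t (suc i) = s≗t i
insertAt-cong {n = suc n}   (suc j) z s≗t zero    = s≗t zero
insertAt-cong {n = suc n}   (suc j) z s≗t (suc i) = insertAt-cong j z (s≗t ∘ suc) i

++-take-drop : ∀ m {n} (w : Vector A (m ℕ.+ n)) → take m w ++ᵛ drop m w ≗ w
++-take-drop m {n} w k = ≡.trans (lemma (splitAt m k)) (cong w (join-splitAt m n k))
  where
  lemma : ∀ s → [ take m w , drop m w ] s ≡ w (join m n s)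
  lemma (inj₁ _) = refl
  lemma (inj₂ _) = refl

module ListSums where

  open import Data.Nat using (_+_; _*_; _≤_; z≤n)
  open import Algebra.Properties.CommutativeSemigroup ℕP.+-commutativeSemigroup using (interchange)

  ∑ : List A → (A → ℕ) → ℕ
  ∑ []       f = 0
  ∑ (x ∷ xs) f = f x + ∑ xs f

  ∑-cong : ∀ (xs : List A) {f g : A → ℕ} → f ≗ g → ∑ xs f ≡ ∑ xs g
  ∑-cong []       f≗g = refl
  ∑-cong (x ∷ xs) f≗g = cong₂ _+_ (f≗g x) (∑-cong xs f≗g)

  length≡∑1 : ∀ (xs : List A) → length xs ≡ ∑ xs (λ _ → 1)
  length≡∑1 []       = refl
  length≡∑1 (x ∷ xs) = cong suc (length≡∑1 xs)

  ∑-mono-≤ : ∀ (xs : List A) {f g : A → ℕ} → (∀ x → f x ≤ g x) → ∑ xs f ≤ ∑ xs g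
  ∑-mono-≤ []       f≤g = z≤n
  ∑-mono-≤ (x ∷ xs) f≤g = ℕP.+-mono-≤ (f≤g x) (∑-mono-≤ xs f≤g)

  ∑-++ : ∀ (xs ys : List A) f → ∑ (xs ++ ys) f ≡ ∑ xs f + ∑ ys f
  ∑-++ []       ys f = refl
  ∑-++ (x ∷ xs) ys f = ≡.trans (cong (f x +_) (∑-++ xs ys f)) (≡.sym (ℕP.+-assoc (f x) _ _))

  ∑-const : ∀ (xs : List A) c → ∑ xs (λ _ → c) ≡ length xs * c
  ∑-const []       c = refl
  ∑-const (x ∷ xs) c = cong (c +_) (∑-const xs c)

  ∑-*ˡ : ∀ (xs : List A) c f → ∑ xs (λ x → c * f x) ≡ c * ∑ xs f
  ∑-*ˡ []       c f = ≡.sym (ℕP.*-zeroʳ c)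
  ∑-*ˡ (x ∷ xs) c f = ≡.trans (cong (c * f x +_) (∑-*ˡ xs c f)) (≡.sym (ℕP.*-distribˡ-+ c (f x) _))

  ∑-*ʳ : ∀ (xs : List A) c f → ∑ xs (λ x → f x * c) ≡ ∑ xs f * c
  ∑-*ʳ []       c f = refl
  ∑-*ʳ (x ∷ xs) c f = ≡.trans (cong (f x * c +_) (∑-*ʳ xs c f)) (≡.sym (ℕP.*-distribʳ-+ c (f x) _))

  ∑-+ : ∀ (xs : List A) f g → ∑ xs (λ x → f x + g x) ≡ ∑ xs f + ∑ xs g
  ∑-+ []       f g = refl
  ∑-+ (x ∷ xs) f g = ≡.trans (cong (f x + g x +_) (∑-+ xs f g)) (interchange (f x) (g x) _ _)

  ∑-map : ∀ (h : A → B) (xs : List A) f → ∑ (map h xs) f ≡ ∑ xs (f ∘ h)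
  ∑-map h []       f = refl
  ∑-map h (x ∷ xs) f = cong (f (h x) +_) (∑-map h xs f)

  ∑-concatMap : ∀ (h : A → List B) (xs : List A) f → ∑ (concatMap h xs) f ≡ ∑ xs (λ x → ∑ (h x) f)
  ∑-concatMap h []       f = refl
  ∑-concatMap h (x ∷ xs) f =
    ≡.trans (∑-++ (h x) (concatMap h xs) f) (cong (∑ (h x) f +_) (∑-concatMap h xs f))

  ∑-comm : ∀ (xs : List A) (ys : List B) (f : A → B → ℕ) →
           ∑ xs (λ x → ∑ ys (f x)) ≡ ∑ ys (λ y → ∑ xs (λ x → f x y))
  ∑-comm []       ys f = ≡.sym (≡.trans (∑-const ys 0) (ℕP.*-zeroʳ (length ys)))
  ∑-comm (x ∷ xs) ys f =
    ≡.trans (cong (∑ ys (f x) +_) (∑-comm xs ys f)) (≡.sym (∑-+ ys (f x) _))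

  module _ {p} {P : A → Set p} (P? : ∀ x → Dec (P x)) where

    rejects : A → ℕ
    rejects x with P? x
    ... | yes _ = 0
    ... | no  _ = 1

    length-filter+∑-rejects : ∀ xs → length (filter P? xs) + ∑ xs rejects ≡ length xs
    length-filter+∑-rejects []       = refl
    length-filter+∑-rejects (x ∷ xs) with P? x
    ... | yes _ = cong suc (length-filter+∑-rejects xs)
    ... | no  _ = ≡.trans (ℕP.+-suc _ _) (cong suc (length-filter+∑-rejects xs))

    length-filter-¬≡∑-rejects : ∀ xs → length (filter (¬? ∘ P?) xs) ≡ ∑ xs rejects
    length-filter-¬≡∑-rejects []       = refl
    length-filter-¬≡∑-rejects (x ∷ xs) with P? x
    ... | yes _ = length-filter-¬≡∑-rejects xs
    ... | no  _ = cong suc (length-filter-¬≡∑-rejects xs)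

  rejects-∘ : ∀ {p} {P : A → Set p} (P? : ∀ x → Dec (P x)) (g : B → A) x →
              rejects (P? ∘ g) x ≡ rejects P? (g x)
  rejects-∘ P? g x with P? (g x)
  ... | yes _ = refl
  ... | no  _ = refl

module Blocks where

  open import Data.Nat using (zero; _+_)
  open import Function.Bundles using (_↔_; mk↔ₛ′)

  blockDim : ∀ r → (Fin r → ℕ) → ℕ
  blockDim zero    ms = 0
  blockDim (suc r) ms = ms zero + blockDim r (ms ∘ suc)

  inject : ∀ r ms → Σ (Fin r) (Fin ∘ ms) → Fin (blockDim r ms)
  inject (suc r) ms (zero  , a) = a ↑ˡ blockDim r (ms ∘ suc)
  inject (suc r) ms (suc k , a) = ms zero ↑ʳ inject r (ms ∘ suc) (k , a)

  locate : ∀ r ms → Fin (blockDim r ms) → Σ (Fin r) (Fin ∘ ms)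
  locate (suc r) ms i with splitAt (ms zero) i
  ... | inj₁ a = zero , a
  ... | inj₂ j = let (k , a) = locate r (ms ∘ suc) j in suc k , a

  locate-inject : ∀ r ms p → locate r ms (inject r ms p) ≡ p
  locate-inject (suc r) ms (zero  , a) rewrite splitAt-↑ˡ (ms zero) a (blockDim r (ms ∘ suc)) = refl
  locate-inject (suc r) ms (suc k , a)
    rewrite splitAt-↑ʳ (ms zero) (blockDim r (ms ∘ suc)) (inject r (ms ∘ suc) (k , a))
          | locate-inject r (ms ∘ suc) (k , a) = refl

  inject-locate : ∀ r ms i → inject r ms (locate r ms i) ≡ i
  inject-locate (suc r) ms i with splitAt (ms zero) i in eq
  ... | inj₁ a = splitAt⁻¹-↑ˡ eq
  ... | inj₂ j = ≡.trans (cong (ms zero ↑ʳ_) (inject-locate r (ms ∘ suc) j)) (splitAt⁻¹-↑ʳ eq)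

  blocks : ∀ r ms → Fin (blockDim r ms) ↔ Σ (Fin r) (Fin ∘ ms)
  blocks r ms = mk↔ₛ′ (locate r ms) (inject r ms) (locate-inject r ms) (inject-locate r ms)

module ExponentSets where

  open import Data.Nat using (zero)
  open Blocks using (blockDim; inject)

  _⊗_ : ∀ {m n} → (ℤ^ m → Set) → (ℤ^ n → Set) → ℤ^ (m ℕ.+ n) → Set
  _⊗_ {m} S T w = S (take m w) × T (drop m w)

  ⨂ : ∀ r ms → ((k : Fin r) → ℤ^ (ms k) → Set) → ℤ^ (blockDim r ms) → Set
  ⨂ zero    ms S = λ _ → ⊤
  ⨂ (suc r) ms S = S zero ⊗ ⨂ r (ms ∘ suc) (S ∘ suc)

  ⨂-respects : ∀ r ms S → (∀ k → S k Respects _≗_) → ⨂ r ms S Respects _≗_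
  ⨂-respects zero    ms S S-resp w≗w′ _       = tt
  ⨂-respects (suc r) ms S S-resp w≗w′ (s , t) =
    S-resp zero (w≗w′ ∘ (_↑ˡ _)) s , ⨂-respects r (ms ∘ suc) (S ∘ suc) (S-resp ∘ suc) (w≗w′ ∘ (ms zero ↑ʳ_)) t

  ⨂⇒blockwise : ∀ r ms S w → ⨂ r ms S w → ∀ k → S k (w ∘ inject r ms ∘ (k ,_))
  ⨂⇒blockwise (suc r) ms S w (s , t) zero    = s
  ⨂⇒blockwise (suc r) ms S w (s , t) (suc k) = ⨂⇒blockwise r (ms ∘ suc) (S ∘ suc) (drop (ms zero) w) t k

  blockwise⇒⨂ : ∀ r ms S w → (∀ k → S k (w ∘ inject r ms ∘ (k ,_))) → ⨂ r ms S w
  blockwise⇒⨂ zero    ms S w blockwise = tt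
  blockwise⇒⨂ (suc r) ms S w blockwise =
    blockwise zero , blockwise⇒⨂ r (ms ∘ suc) (S ∘ suc) (drop (ms zero) w) (blockwise ∘ suc)

module TorusSums {c ℓ} (F : FiniteField c ℓ) where

  open FiniteField F using (Carrier)
  open import Data.Nat using (zero; _+_)
  open ListSums
  open ≡.≡-Reasoning
  open Toric F
  open import Data.Fin.Permutation as Perm using (Permutation; _⟨$⟩ʳ_; _⟨$⟩ˡ_)

  ∑-torus-suc : ∀ n (h : Vector Carrier (suc n) → ℕ) → Congruent _≗_ _≡_ h →
    ∑ (torus (suc n)) h ≡ ∑ nonzeroElements (λ z → ∑ (torus n) (λ t → h (z ∷ᵛ t)))
  ∑-torus-suc n h h-cong = ≡.trans (∑-concatMap _ nonzeroElements h)
    (∑-cong nonzeroElements λ z → ≡.trans (∑-map _ (torus n) h)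
      (∑-cong (torus n) λ t → h-cong λ { zero → refl ; (suc i) → refl }))

  ∑-torus-+ : ∀ m n (h : Vector Carrier (m + n) → ℕ) → Congruent _≗_ _≡_ h →
    ∑ (torus (m + n)) h ≡ ∑ (torus m) (λ s → ∑ (torus n) (λ t → h (s ++ᵛ t)))
  ∑-torus-+ zero    n h h-cong = ≡.sym (ℕP.+-identityʳ _)
  ∑-torus-+ (suc m) n h h-cong = begin
    ∑ (torus (suc m + n)) h
      ≡⟨ ∑-torus-suc (m + n) h h-cong ⟩
    ∑ nonzeroElements (λ z → ∑ (torus (m + n)) (λ t → h (z ∷ᵛ t)))
      ≡⟨ ∑-cong nonzeroElements (λ z → ∑-torus-+ m n _ (h-cong ∘ ∷-cong z)) ⟩
    ∑ nonzeroElements (λ z → ∑ (torus m) (λ s → ∑ (torus n) (λ t → h (z ∷ᵛ (s ++ᵛ t)))))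
      ≡⟨ ∑-cong nonzeroElements (λ z → ∑-cong (torus m) λ s → ∑-cong (torus n) λ t →
           h-cong (∷-++ z s t)) ⟩
    ∑ nonzeroElements (λ z → ∑ (torus m) (λ s → ∑ (torus n) (λ t → h ((z ∷ᵛ s) ++ᵛ t))))
      ≡⟨ ∑-torus-suc m _ (λ s≗s′ → ∑-cong (torus n) λ t → h-cong (++-cong _ _ s≗s′ λ _ → refl)) ⟨
    ∑ (torus (suc m)) (λ s → ∑ (torus n) (λ t → h (s ++ᵛ t))) ∎

  ∑-torus-insertAt : ∀ n (j : Fin (suc n)) (h : Vector Carrier (suc n) → ℕ) → Congruent _≗_ _≡_ h →
    ∑ (torus (suc n)) h ≡ ∑ nonzeroElements (λ z → ∑ (torus n) (λ t → h (insertAt t j z)))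
  ∑-torus-insertAt n       zero    h h-cong = ≡.trans (∑-torus-suc n h h-cong)
    (∑-cong nonzeroElements λ z → ∑-cong (torus n) λ t → h-cong λ { zero → refl ; (suc i) → refl })
  ∑-torus-insertAt (suc n) (suc j) h h-cong = begin
    ∑ (torus (suc (suc n))) h
      ≡⟨ ∑-torus-suc (suc n) h h-cong ⟩
    ∑ nonzeroElements (λ y → ∑ (torus (suc n)) (λ t → h (y ∷ᵛ t)))
      ≡⟨ ∑-cong nonzeroElements (λ y → ∑-torus-insertAt n j _ (h-cong ∘ ∷-cong y)) ⟩
    ∑ nonzeroElements (λ y → ∑ nonzeroElements (λ z → ∑ (torus n) (λ t → h (y ∷ᵛ insertAt t j z))))
      ≡⟨ ∑-comm nonzeroElements nonzeroElements _ ⟩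
    ∑ nonzeroElements (λ z → ∑ nonzeroElements (λ y → ∑ (torus n) (λ t → h (y ∷ᵛ insertAt t j z))))
      ≡⟨ ∑-cong nonzeroElements (λ z → ∑-cong nonzeroElements λ y → ∑-cong (torus n) λ t →
           h-cong λ { zero → refl ; (suc i) → refl }) ⟩
    ∑ nonzeroElements (λ z → ∑ nonzeroElements (λ y → ∑ (torus n) (λ t → h (insertAt (y ∷ᵛ t) (suc j) z))))
      ≡⟨ ∑-cong nonzeroElements (λ z → ∑-torus-suc n _ (h-cong ∘ insertAt-cong (suc j) z)) ⟨
    ∑ nonzeroElements (λ z → ∑ (torus (suc n)) (λ t → h (insertAt t (suc j) z))) ∎

  ∑-torus-permute : ∀ m n (π : Permutation m n) (h : Vector Carrier m → ℕ) → Congruent _≗_ _≡_ h →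
    ∑ (torus m) h ≡ ∑ (torus n) (λ t → h (t ∘ (π ⟨$⟩ʳ_)))
  ∑-torus-permute zero    zero    π h h-cong = cong (_+ 0) (h-cong λ ())
  ∑-torus-permute zero    (suc n) π h h-cong with () ← π ⟨$⟩ˡ zero
  ∑-torus-permute (suc m) zero    π h h-cong with () ← π ⟨$⟩ʳ zero
  -- Split off the first source coordinate and reinsert it at its image j.
  ∑-torus-permute (suc m) (suc n) π h h-cong = begin
    ∑ (torus (suc m)) h
      ≡⟨ ∑-torus-suc m h h-cong ⟩
    ∑ nonzeroElements (λ z → ∑ (torus m) (λ s → h (z ∷ᵛ s)))
      ≡⟨ ∑-cong nonzeroElements (λ z → ∑-torus-permute m n π₀ _ (h-cong ∘ ∷-cong z)) ⟩
    ∑ nonzeroElements (λ z → ∑ (torus n) (λ t → h (z ∷ᵛ (t ∘ (π₀ ⟨$⟩ʳ_)))))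
      ≡⟨ ∑-cong nonzeroElements (λ z → ∑-cong (torus n) λ t → h-cong (insertAt-permute z t)) ⟩
    ∑ nonzeroElements (λ z → ∑ (torus n) (λ t → h (insertAt t j z ∘ (π ⟨$⟩ʳ_))))
      ≡⟨ ∑-torus-insertAt n j _ (λ t≗t′ → h-cong (t≗t′ ∘ (π ⟨$⟩ʳ_))) ⟨
    ∑ (torus (suc n)) (λ t → h (t ∘ (π ⟨$⟩ʳ_))) ∎
    where
    j  = π ⟨$⟩ʳ zero
    π₀ = Perm.remove zero π
    insertAt-permute : ∀ z (t : Vector Carrier n) → z ∷ᵛ (t ∘ (π₀ ⟨$⟩ʳ_)) ≗ insertAt t j z ∘ (π ⟨$⟩ʳ_)
    insertAt-permute z t zero    = ≡.sym (insertAt-lookup t j z)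
    insertAt-permute z t (suc i) = ≡.sym (≡.trans (cong (insertAt t j z) (Perm.punchIn-permute π zero i))
                                                   (insertAt-punchIn t j z _))

module Polynomials {c ℓ} (F : FiniteField c ℓ) where

  open FiniteField F hiding (zero)
    renaming (refl to ≈-refl; sym to ≈-sym; trans to ≈-trans)
  open Toric F
  open import Data.Nat using (zero)
  open import Data.Fin.Permutation as Perm using (Permutation; _⟨$⟩ʳ_; _⟨$⟩ˡ_)
  open import Algebra.Properties.CommutativeMonoid.Sum *-commutativeMonoid using (sum; sum-permute)
  private module ≈-Reasoning = Relation.Binary.Reasoning.Setoid setoid

  prodF-cong : ∀ {n} {f g : Vector Carrier n} → (∀ i → f i ≈ g i) → prodF f ≈ prodF g
  prodF-cong {zero}  f≈g = ≈-refl
  prodF-cong {suc n} f≈g = *-cong (f≈g zero) (prodF-cong (f≈g ∘ suc))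

  prodF-++ : ∀ m {n} (f : Vector Carrier (m ℕ.+ n)) → prodF f ≈ prodF (take m f) * prodF (drop m f)
  prodF-++ zero    f = ≈-sym (*-identityˡ _)
  prodF-++ (suc m) f = ≈-trans (*-congˡ (prodF-++ m (f ∘ suc))) (≈-sym (*-assoc _ _ _))

  prodF≡sum : ∀ {n} (f : Vector Carrier n) → prodF f ≡ sum f
  prodF≡sum {zero}  f = refl
  prodF≡sum {suc n} f = cong (f zero *_) (prodF≡sum (f ∘ suc))

  prodF-permute : ∀ {m n} (f : Vector Carrier n) (π : Permutation m n) → prodF f ≈ prodF (f ∘ (π ⟨$⟩ʳ_))
  prodF-permute f π = begin
    prodF f                ≡⟨ prodF≡sum f ⟩
    sum f                  ≈⟨ sum-permute f π ⟩
    sum (f ∘ (π ⟨$⟩ʳ_))    ≡⟨ prodF≡sum (f ∘ (π ⟨$⟩ʳ_)) ⟨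
    prodF (f ∘ (π ⟨$⟩ʳ_))  ∎
    where open ≈-Reasoning

  monomial-cong : ∀ {n} (u : ℤ^ n) {s t : Vector Carrier n} → s ≗ t → monomial u s ≈ monomial u t
  monomial-cong u s≗t = prodF-cong λ i → reflexive (cong (_^ℤ u i) (s≗t i))

  monomial-exponent-cong : ∀ {n} {u v : ℤ^ n} (t : Vector Carrier n) → u ≗ v → monomial u t ≈ monomial v t
  monomial-exponent-cong t u≗v = prodF-cong λ i → reflexive (cong (t i ^ℤ_) (u≗v i))

  monomial-++ : ∀ m {n} (w : ℤ^ (m ℕ.+ n)) (s : Vector Carrier m) (t : Vector Carrier n) →
                monomial w (s ++ᵛ t) ≈ monomial (take m w) s * monomial (drop m w) t
  monomial-++ m {n} w s t = ≈-trans (prodF-++ m _)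
    (*-cong (prodF-cong λ i → reflexive (cong (_^ℤ w (i ↑ˡ n)) (lookup-++ˡ s t i)))
            (prodF-cong λ j → reflexive (cong (_^ℤ w (m ↑ʳ j)) (lookup-++ʳ s t j))))

  monomial-permute : ∀ {m n} (π : Permutation m n) (u : ℤ^ m) (t : Vector Carrier n) →
                     monomial (u ∘ (π ⟨$⟩ˡ_)) t ≈ monomial u (t ∘ (π ⟨$⟩ʳ_))
  monomial-permute π u t = ≈-trans (prodF-permute _ π)
    (prodF-cong λ i → reflexive (cong (λ k → t (π ⟨$⟩ʳ i) ^ℤ u k) (Perm.inverseˡ π)))

  eval-cong : ∀ {n} (f : LaurentPoly n) {s t : Vector Carrier n} → s ≗ t → eval f s ≈ eval f t
  eval-cong []            s≗t = ≈-refl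
  eval-cong ((a , u) ∷ f) s≗t = +-cong (*-congˡ (monomial-cong u s≗t)) (eval-cong f s≗t)

  eval-++ : ∀ {n} (f g : LaurentPoly n) t → eval (f ++ g) t ≈ eval f t + eval g t
  eval-++ []            g t = ≈-sym (+-identityˡ _)
  eval-++ ((a , u) ∷ f) g t = ≈-trans (+-congˡ (eval-++ f g t)) (≈-sym (+-assoc _ _ _))

  coeff-++ : ∀ {n} (f g : LaurentPoly n) v → coeff (f ++ g) v ≈ coeff f v + coeff g v
  coeff-++ []            g v = ≈-sym (+-identityˡ _)
  coeff-++ ((a , u) ∷ f) g v with u ≟ᵛ v
  ... | yes _ = ≈-trans (+-congˡ (coeff-++ f g v)) (≈-sym (+-assoc _ _ _))
  ... | no  _ = coeff-++ f g v

  coeff-cong : ∀ {n} (f : LaurentPoly n) {v w : ℤ^ n} → v ≗ w → coeff f v ≡ coeff f w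
  coeff-cong []            v≗w = refl
  coeff-cong ((a , u) ∷ f) {v} {w} v≗w with u ≟ᵛ v | u ≟ᵛ w
  ... | yes _   | yes _   = cong (a +_) (coeff-cong f v≗w)
  ... | no  _   | no  _   = coeff-cong f v≗w
  ... | yes u≗v | no  u≉w = ⊥-elim (u≉w λ i → ≡.trans (u≗v i) (v≗w i))
  ... | no  u≉v | yes u≗w = ⊥-elim (u≉v λ i → ≡.trans (u≗w i) (≡.sym (v≗w i)))

module Weight {c ℓ} (F : FiniteField c ℓ) where

  open FiniteField F hiding (zero)
    renaming (refl to ≈-refl; sym to ≈-sym; trans to ≈-trans)
  open Toric F
  open ListSums
  open TorusSums F
  open Polynomials F
  open import Level using (_⊔_)
  open import Data.Nat using (zero; _∸_; _≤_)
  open import Data.Nat.Properties using (≤-antisym)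
  private module ≈-Reasoning = Relation.Binary.Reasoning.Setoid setoid

  wt : Carrier → ℕ
  wt = rejects (_≟ 0#)

  wt-cong : ∀ {x y} → x ≈ y → wt x ≡ wt y
  wt-cong {x} {y} x≈y with x ≟ 0# | y ≟ 0#
  ... | yes _   | yes _   = refl
  ... | no  _   | no  _   = refl
  ... | yes x≈0 | no  y≉0 = ⊥-elim (y≉0 (≈-trans (≈-sym x≈y) x≈0))
  ... | no  x≉0 | yes y≈0 = ⊥-elim (x≉0 (≈-trans x≈y y≈0))

  wt-≈0 : ∀ {x} → x ≈ 0# → wt x ≡ 0
  wt-≈0 {x} x≈0 with x ≟ 0#
  ... | yes _   = refl
  ... | no  x≉0 = ⊥-elim (x≉0 x≈0)

  wt-≉0 : ∀ {x} → ¬ (x ≈ 0#) → wt x ≡ 1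
  wt-≉0 {x} x≉0 with x ≟ 0#
  ... | yes x≈0 = ⊥-elim (x≉0 x≈0)
  ... | no  _   = refl

  *-≉0 : ∀ {x y} → ¬ (x ≈ 0#) → ¬ (y ≈ 0#) → ¬ (x * y ≈ 0#)
  *-≉0 {x} {y} x≉0 y≉0 xy≈0 = x≉0 (begin
    x                ≈⟨ *-identityʳ x ⟨
    x * 1#           ≈⟨ *-congˡ (inverseʳ y y≉0) ⟨
    x * (y * y ⁻¹)   ≈⟨ *-assoc x y _ ⟨
    x * y * y ⁻¹     ≈⟨ *-congʳ xy≈0 ⟩
    0# * y ⁻¹        ≈⟨ zeroˡ _ ⟩
    0#               ∎)
    where open ≈-Reasoning

  wt-* : ∀ x y → wt (x * y) ≡ wt x ℕ.* wt y
  wt-* x y with x ≟ 0# | y ≟ 0#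
  ... | yes x≈0 | _       = wt-≈0 (≈-trans (*-congʳ x≈0) (zeroˡ y))
  ... | no  _   | yes y≈0 = ≡.trans (wt-≈0 (≈-trans (*-congˡ y≈0) (zeroʳ x))) (ℕP.*-zeroʳ 1)
  ... | no  x≉0 | no  y≉0 = wt-≉0 (*-≉0 x≉0 y≉0)

  length-filter-≟0≡1 : ∀ xs → AllPairs (λ x y → ¬ (x ≈ y)) xs → Any (0# ≈_) xs →
                     length (filter (_≟ 0#) xs) ≡ 1
  length-filter-≟0≡1 (x ∷ xs) (x≉xs ∷ _) _ with x ≟ 0#
  ... | yes x≈0 = cong suc (none xs (All.map (λ x≉y y≈0 → x≉y (≈-trans x≈0 (≈-sym y≈0))) x≉xs))
    where
    none : ∀ ys → All (λ y → ¬ (y ≈ 0#)) ys → length (filter (_≟ 0#) ys) ≡ 0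
    none []       []         = refl
    none (y ∷ ys) (y≉0 ∷ ps) with y ≟ 0#
    ... | yes y≈0 = ⊥-elim (y≉0 y≈0)
    ... | no  _   = none ys ps
  length-filter-≟0≡1 (x ∷ xs) (_ ∷ distinct) (here 0≈x)  | no x≉0 = ⊥-elim (x≉0 (≈-sym 0≈x))
  length-filter-≟0≡1 (x ∷ xs) (_ ∷ distinct) (there 0∈xs) | no _  = length-filter-≟0≡1 xs distinct 0∈xs

  length-nonzeroElements : length nonzeroElements ≡ size ∸ 1
  length-nonzeroElements = begin
    length nonzeroElements
      ≡⟨ length-filter-¬≡∑-rejects (_≟ 0#) elements ⟩
    ∑ elements wt
      ≡⟨ ℕP.m+n∸m≡n 1 _ ⟨
    1 ℕ.+ ∑ elements wt ∸ 1
      ≡⟨ cong (λ k → k ℕ.+ ∑ elements wt ∸ 1) zeros≡1 ⟨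
    length (filter (_≟ 0#) elements) ℕ.+ ∑ elements wt ∸ 1
      ≡⟨ cong (_∸ 1) (length-filter+∑-rejects (_≟ 0#) elements) ⟩
    size ∸ 1 ∎
    where
    open ≡.≡-Reasoning
    zeros≡1 = length-filter-≟0≡1 elements distinct (complete 0#)

  length-torus : ∀ n → length (torus n) ≡ (size ∸ 1) ^ n
  length-torus zero    = refl
  length-torus (suc n) = begin
    length (torus (suc n))                            ≡⟨ length≡∑1 (torus (suc n)) ⟩
    ∑ (torus (suc n)) (λ _ → 1)                       ≡⟨ ∑-torus-suc n _ (λ _ → refl) ⟩
    ∑ nonzeroElements (λ _ → ∑ (torus n) (λ _ → 1))   ≡⟨ ∑-const nonzeroElements _ ⟩
    length nonzeroElements ℕ.* ∑ (torus n) (λ _ → 1)  ≡⟨ cong (length nonzeroElements ℕ.*_) (length≡∑1 (torus n)) ⟨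
    length nonzeroElements ℕ.* length (torus n)       ≡⟨ cong₂ ℕ._*_ length-nonzeroElements (length-torus n) ⟩
    (size ∸ 1) ℕ.* (size ∸ 1) ^ n                     ∎
    where open ≡.≡-Reasoning

  weight : ∀ {n} → LaurentPoly n → ℕ
  weight {n} f = ∑ (torus n) (wt ∘ eval f)

  wt∘eval-cong : ∀ {n} (f : LaurentPoly n) → Congruent _≗_ _≡_ (wt ∘ eval f)
  wt∘eval-cong f = wt-cong ∘ eval-cong f

  Z+weight : ∀ {n} (f : LaurentPoly n) → Z f ℕ.+ weight f ≡ (size ∸ 1) ^ n
  Z+weight {n} f = begin
    Z f ℕ.+ weight f
      ≡⟨ cong (Z f ℕ.+_) (∑-cong (torus n) (rejects-∘ (_≟ 0#) (eval f))) ⟨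
    Z f ℕ.+ ∑ (torus n) (rejects (λ t → eval f t ≟ 0#))
      ≡⟨ length-filter+∑-rejects (λ t → eval f t ≟ 0#) (torus n) ⟩
    length (torus n)
      ≡⟨ length-torus n ⟩
    (size ∸ 1) ^ n ∎
    where open ≡.≡-Reasoning

  weight≡∣torus∣∸Z : ∀ {n} (f : LaurentPoly n) → weight f ≡ (size ∸ 1) ^ n ∸ Z f
  weight≡∣torus∣∸Z f = ≡.trans (≡.sym (ℕP.m+n∸m≡n (Z f) (weight f))) (cong (_∸ Z f) (Z+weight f))

  Supported : ∀ {n} → (ℤ^ n → Set) → LaurentPoly n → Set c
  Supported E f = All (E ∘ proj₂) f

  record IsMinWeight {n} (E : ℤ^ n → Set) (d : ℕ) : Set (c ⊔ ℓ) where
    field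
      weight-≥          : ∀ f → Supported E f → NonZeroPoly f → d ≤ weight f
      witness           : LaurentPoly n
      witness-supported : Supported E witness
      witness-nonzero   : NonZeroPoly witness
      witness-weight    : weight witness ≡ d

  isMinWeight-unique : ∀ {n} {E : ℤ^ n → Set} {d d′} → IsMinWeight E d → IsMinWeight E d′ → d ≡ d′
  isMinWeight-unique m m′ = ≤-antisym
    (≡.subst (_ ≤_) (witness-weight m′) (weight-≥ m (witness m′) (witness-supported m′) (witness-nonzero m′)))
    (≡.subst (_ ≤_) (witness-weight m) (weight-≥ m′ (witness m) (witness-supported m) (witness-nonzero m)))
    where open IsMinWeight

  minDistance⇒isMinWeight : ∀ {n} {S : ℚ^ n → Set} {d} → MinDistance S d → IsMinWeight (LatticePoint S) d
  minDistance⇒isMinWeight {n} (z , ((f , f∈L , f≢0 , Zf≡z) , Z≤z) , d≡) = record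
    { weight-≥          = λ g g∈L g≢0 → ≡.subst₂ _≤_ (≡.sym d≡) (≡.sym (weight≡∣torus∣∸Z g))
                            (ℕP.∸-monoʳ-≤ ((size ∸ 1) ^ n) (Z≤z g g∈L g≢0))
    ; witness           = f
    ; witness-supported = f∈L
    ; witness-nonzero   = f≢0
    ; witness-weight    = ≡.trans (weight≡∣torus∣∸Z f) (≡.trans (cong ((size ∸ 1) ^ n ∸_) Zf≡z) (≡.sym d≡))
    }

module Products {c ℓ} (F : FiniteField c ℓ) where

  open FiniteField F hiding (zero)
    renaming (refl to ≈-refl; sym to ≈-sym; trans to ≈-trans)
  open Toric F
  open ListSums
  open TorusSums F
  open Polynomials F
  open Weight F
  open ExponentSets
  open import Data.Nat using (zero; _≤_)
  open import Algebra.Properties.CommutativeSemigroup *-commutativeSemigroup using (interchange)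
  private module ≈-Reasoning = Relation.Binary.Reasoning.Setoid setoid

  module _ {m n : ℕ} where

    -- The coefficient of y^v when f(x, y) is read as a polynomial in y over F[x^±1].
    yCoeff : LaurentPoly (m ℕ.+ n) → ℤ^ n → LaurentPoly m
    yCoeff []            v = []
    yCoeff ((a , w) ∷ f) v with drop m w ≟ᵛ v
    ... | yes _ = (a , take m w) ∷ yCoeff f v
    ... | no  _ = yCoeff f v

    yCoeff-supported : ∀ {S T} f v → Supported (S ⊗ T) f → Supported S (yCoeff f v)
    yCoeff-supported {S} {T} []            v []            = []
    yCoeff-supported {S} {T} ((a , w) ∷ f) v (w∈ST ∷ f∈ST) with drop m w ≟ᵛ v
    ... | yes _ = proj₁ w∈ST ∷ yCoeff-supported {S} {T} f v f∈ST
    ... | no  _ = yCoeff-supported {S} {T} f v f∈ST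

    coeff-yCoeff : ∀ f v u → coeff (yCoeff f v) u ≡ coeff f (u ++ᵛ v)
    coeff-yCoeff []            v u = refl
    coeff-yCoeff ((a , w) ∷ f) v u with drop m w ≟ᵛ v
    coeff-yCoeff ((a , w) ∷ f) v u | no drop≉v with w ≟ᵛ (u ++ᵛ v)
    ... | yes w≗uv = ⊥-elim (drop≉v λ j → ≡.trans (w≗uv (m ↑ʳ j)) (lookup-++ʳ u v j))
    ... | no  _    = coeff-yCoeff f v u
    coeff-yCoeff ((a , w) ∷ f) v u | yes drop≗v with take m w ≟ᵛ u | w ≟ᵛ (u ++ᵛ v)
    ... | yes _       | yes _    = cong (a +_) (coeff-yCoeff f v u)
    ... | no  _       | no  _    = coeff-yCoeff f v u
    ... | yes take≗u  | no  w≉uv =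
      ⊥-elim (w≉uv λ k → ≡.trans (≡.sym (++-take-drop m w k)) (++-cong _ _ take≗u drop≗v k))
    ... | no  take≉u  | yes w≗uv = ⊥-elim (take≉u λ i → ≡.trans (w≗uv (i ↑ˡ n)) (lookup-++ˡ u v i))

    partialEval : LaurentPoly (m ℕ.+ n) → Vector Carrier m → LaurentPoly n
    partialEval f s = map (λ (a , w) → a * monomial (take m w) s , drop m w) f

    partialEval-supported : ∀ {S T} f s → Supported (S ⊗ T) f → Supported T (partialEval f s)
    partialEval-supported {S} {T} []            s []            = []
    partialEval-supported {S} {T} ((a , w) ∷ f) s (w∈ST ∷ f∈ST) = proj₂ w∈ST ∷ partialEval-supported {S} {T} f s f∈ST

    coeff-partialEval : ∀ f s v → coeff (partialEval f s) v ≡ eval (yCoeff f v) s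
    coeff-partialEval []            s v = refl
    coeff-partialEval ((a , w) ∷ f) s v with drop m w ≟ᵛ v
    ... | yes _ = cong (a * monomial (take m w) s +_) (coeff-partialEval f s v)
    ... | no  _ = coeff-partialEval f s v

    eval-partialEval : ∀ f s t → eval f (s ++ᵛ t) ≈ eval (partialEval f s) t
    eval-partialEval []            s t = ≈-refl
    eval-partialEval ((a , w) ∷ f) s t =
      +-cong (≈-trans (*-congˡ (monomial-++ m w s t)) (≈-sym (*-assoc _ _ _))) (eval-partialEval f s t)

    weight-partialEval : ∀ f → weight f ≡ ∑ (torus m) (λ s → weight (partialEval f s))
    weight-partialEval f = ≡.trans (∑-torus-+ m n _ (wt∘eval-cong f))
      (∑-cong (torus m) λ s → ∑-cong (torus n) λ t → wt-cong (eval-partialEval f s t))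

    weight-⊗-≥ : ∀ {S T d₁ d₂} →
      (∀ g → Supported S g → NonZeroPoly g → d₁ ≤ weight g) →
      (∀ h → Supported T h → NonZeroPoly h → d₂ ≤ weight h) →
      ∀ f → Supported (S ⊗ T) f → NonZeroPoly f → d₁ ℕ.* d₂ ≤ weight f
    weight-⊗-≥ {S} {T} {d₁} {d₂} S-bound T-bound f f∈ST (w , f[w]≉0) = begin
      d₁ ℕ.* d₂                                     ≤⟨ ℕP.*-monoˡ-≤ d₂ (S-bound g (yCoeff-supported {S} {T} f v f∈ST) g≢0) ⟩
      weight g ℕ.* d₂                               ≡⟨ ∑-*ʳ (torus m) d₂ (wt ∘ eval g) ⟨
      ∑ (torus m) (λ s → wt (eval g s) ℕ.* d₂)      ≤⟨ ∑-mono-≤ (torus m) slice-bound ⟩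
      ∑ (torus m) (λ s → weight (partialEval f s))  ≡⟨ weight-partialEval f ⟨
      weight f                                      ∎
      where
      open ℕP.≤-Reasoning
      v = drop m w
      g = yCoeff f v
      g≢0 : NonZeroPoly g
      g≢0 = take m w , λ g[take]≈0 → f[w]≉0 (≈-trans
        (reflexive (≡.sym (≡.trans (coeff-yCoeff f v (take m w)) (coeff-cong f (++-take-drop m w)))))
        g[take]≈0)
      slice-bound : ∀ s → wt (eval g s) ℕ.* d₂ ≤ weight (partialEval f s)
      slice-bound s with eval g s ≟ 0#
      ... | yes _    = ℕ.z≤n
      ... | no  g≉0  = ℕP.≤-trans (ℕP.≤-reflexive (ℕP.+-identityʳ d₂))
        (T-bound (partialEval f s) (partialEval-supported {S} {T} f s f∈ST)
                 (v , λ fs[v]≈0 → g≉0 (≈-trans (reflexive (≡.sym (coeff-partialEval f s v))) fs[v]≈0)))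

    _⊛ₜ_ : Carrier × ℤ^ m → LaurentPoly n → LaurentPoly (m ℕ.+ n)
    (a , u) ⊛ₜ g = map (λ (b , v) → a * b , u ++ᵛ v) g

    _⊛_ : LaurentPoly m → LaurentPoly n → LaurentPoly (m ℕ.+ n)
    f ⊛ g = concatMap (_⊛ₜ g) f

    ⊛-supported : ∀ {S T} → S Respects _≗_ → T Respects _≗_ →
      ∀ f g → Supported S f → Supported T g → Supported (S ⊗ T) (f ⊛ g)
    ⊛-supported {S} {T} S-resp T-resp f g f∈S g∈T = concat⁺ (map⁺ (All.map (λ {(a , u)} → row a u) f∈S))
      where
      row : ∀ a u → S u → Supported (S ⊗ T) ((a , u) ⊛ₜ g)
      row a u u∈S = map⁺ (All.map (λ {(_ , v)} v∈T →
        S-resp (λ i → ≡.sym (lookup-++ˡ u v i)) u∈S , T-resp (λ j → ≡.sym (lookup-++ʳ u v j)) v∈T) g∈T)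

    eval-⊛ₜ : ∀ a u g s t → eval ((a , u) ⊛ₜ g) (s ++ᵛ t) ≈ (a * monomial u s) * eval g t
    eval-⊛ₜ a u []            s t = ≈-sym (zeroʳ _)
    eval-⊛ₜ a u ((b , v) ∷ g) s t = begin
      (a * b) * monomial (u ++ᵛ v) (s ++ᵛ t) + eval ((a , u) ⊛ₜ g) (s ++ᵛ t)
        ≈⟨ +-cong (*-congˡ (monomial-++ m (u ++ᵛ v) s t)) (eval-⊛ₜ a u g s t) ⟩
      (a * b) * (monomial (take m (u ++ᵛ v)) s * monomial (drop m (u ++ᵛ v)) t)
        + (a * monomial u s) * eval g t
        ≈⟨ +-congʳ (*-congˡ (*-cong (monomial-exponent-cong s (lookup-++ˡ u v))
                                     (monomial-exponent-cong t (lookup-++ʳ u v)))) ⟩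
      (a * b) * (monomial u s * monomial v t) + (a * monomial u s) * eval g t
        ≈⟨ +-congʳ (interchange a b _ _) ⟩
      (a * monomial u s) * (b * monomial v t) + (a * monomial u s) * eval g t
        ≈⟨ distribˡ _ _ _ ⟨
      (a * monomial u s) * (b * monomial v t + eval g t) ∎
      where open ≈-Reasoning

    eval-⊛ : ∀ f g s t → eval (f ⊛ g) (s ++ᵛ t) ≈ eval f s * eval g t
    eval-⊛ []            g s t = ≈-sym (zeroˡ _)
    eval-⊛ ((a , u) ∷ f) g s t = begin
      eval ((a , u) ⊛ₜ g ++ f ⊛ g) (s ++ᵛ t)
        ≈⟨ eval-++ ((a , u) ⊛ₜ g) (f ⊛ g) (s ++ᵛ t) ⟩
      eval ((a , u) ⊛ₜ g) (s ++ᵛ t) + eval (f ⊛ g) (s ++ᵛ t)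
        ≈⟨ +-cong (eval-⊛ₜ a u g s t) (eval-⊛ f g s t) ⟩
      (a * monomial u s) * eval g t + eval f s * eval g t
        ≈⟨ distribʳ _ _ _ ⟨
      (a * monomial u s + eval f s) * eval g t ∎
      where open ≈-Reasoning

    coeff-⊛ₜ-≗ : ∀ a {u u₀} g v₀ → u ≗ u₀ → coeff ((a , u) ⊛ₜ g) (u₀ ++ᵛ v₀) ≈ a * coeff g v₀
    coeff-⊛ₜ-≗ a                 []            v₀ u≗u₀ = ≈-sym (zeroʳ a)
    coeff-⊛ₜ-≗ a {u} {u₀} ((b , v) ∷ g) v₀ u≗u₀ with (u ++ᵛ v) ≟ᵛ (u₀ ++ᵛ v₀) | v ≟ᵛ v₀
    ... | yes _    | yes _    = ≈-trans (+-congˡ (coeff-⊛ₜ-≗ a g v₀ u≗u₀)) (≈-sym (distribˡ a b _))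
    ... | no  _    | no  _    = coeff-⊛ₜ-≗ a g v₀ u≗u₀
    ... | yes uv≗  | no  v≉v₀ = ⊥-elim (v≉v₀ (++-injectiveʳ u u₀ uv≗))
    ... | no  uv≉  | yes v≗v₀ = ⊥-elim (uv≉ (++-cong u u₀ u≗u₀ v≗v₀))

    coeff-⊛ₜ-≉ : ∀ a {u u₀} g v₀ → ¬ (u ≗ u₀) → coeff ((a , u) ⊛ₜ g) (u₀ ++ᵛ v₀) ≈ 0#
    coeff-⊛ₜ-≉ a                 []            v₀ u≉u₀ = ≈-refl
    coeff-⊛ₜ-≉ a {u} {u₀} ((b , v) ∷ g) v₀ u≉u₀ with (u ++ᵛ v) ≟ᵛ (u₀ ++ᵛ v₀)
    ... | yes uv≗ = ⊥-elim (u≉u₀ (++-injectiveˡ u u₀ uv≗))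
    ... | no  _   = coeff-⊛ₜ-≉ a g v₀ u≉u₀

    coeff-⊛ : ∀ f g u₀ v₀ → coeff (f ⊛ g) (u₀ ++ᵛ v₀) ≈ coeff f u₀ * coeff g v₀
    coeff-⊛ []            g u₀ v₀ = ≈-sym (zeroˡ _)
    coeff-⊛ ((a , u) ∷ f) g u₀ v₀ with u ≟ᵛ u₀
    ... | yes u≗u₀ = begin
      coeff ((a , u) ⊛ₜ g ++ f ⊛ g) (u₀ ++ᵛ v₀)
        ≈⟨ coeff-++ ((a , u) ⊛ₜ g) (f ⊛ g) (u₀ ++ᵛ v₀) ⟩
      coeff ((a , u) ⊛ₜ g) (u₀ ++ᵛ v₀) + coeff (f ⊛ g) (u₀ ++ᵛ v₀)
        ≈⟨ +-cong (coeff-⊛ₜ-≗ a g v₀ u≗u₀) (coeff-⊛ f g u₀ v₀) ⟩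
      a * coeff g v₀ + coeff f u₀ * coeff g v₀
        ≈⟨ distribʳ _ _ _ ⟨
      (a + coeff f u₀) * coeff g v₀ ∎
      where open ≈-Reasoning
    ... | no  u≉u₀ = begin
      coeff ((a , u) ⊛ₜ g ++ f ⊛ g) (u₀ ++ᵛ v₀)
        ≈⟨ coeff-++ ((a , u) ⊛ₜ g) (f ⊛ g) (u₀ ++ᵛ v₀) ⟩
      coeff ((a , u) ⊛ₜ g) (u₀ ++ᵛ v₀) + coeff (f ⊛ g) (u₀ ++ᵛ v₀)
        ≈⟨ +-cong (coeff-⊛ₜ-≉ a g v₀ u≉u₀) (coeff-⊛ f g u₀ v₀) ⟩
      0# + coeff f u₀ * coeff g v₀
        ≈⟨ +-identityˡ _ ⟩
      coeff f u₀ * coeff g v₀ ∎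
      where open ≈-Reasoning

    ⊛-nonzero : ∀ f g → NonZeroPoly f → NonZeroPoly g → NonZeroPoly (f ⊛ g)
    ⊛-nonzero f g (u , f[u]≉0) (v , g[v]≉0) =
      u ++ᵛ v , λ fg[uv]≈0 → *-≉0 f[u]≉0 g[v]≉0 (≈-trans (≈-sym (coeff-⊛ f g u v)) fg[uv]≈0)

    weight-⊛ : ∀ f g → weight (f ⊛ g) ≡ weight f ℕ.* weight g
    weight-⊛ f g = begin
      weight (f ⊛ g)
        ≡⟨ ∑-torus-+ m n _ (wt∘eval-cong (f ⊛ g)) ⟩
      ∑ (torus m) (λ s → ∑ (torus n) (λ t → wt (eval (f ⊛ g) (s ++ᵛ t))))
        ≡⟨ ∑-cong (torus m) (λ s → ∑-cong (torus n) λ t → ≡.trans (wt-cong (eval-⊛ f g s t)) (wt-* _ _)) ⟩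
      ∑ (torus m) (λ s → ∑ (torus n) (λ t → wt (eval f s) ℕ.* wt (eval g t)))
        ≡⟨ ∑-cong (torus m) (λ s → ∑-*ˡ (torus n) (wt (eval f s)) (wt ∘ eval g)) ⟩
      ∑ (torus m) (λ s → wt (eval f s) ℕ.* weight g)
        ≡⟨ ∑-*ʳ (torus m) (weight g) (wt ∘ eval f) ⟩
      weight f ℕ.* weight g ∎
      where open ≡.≡-Reasoning

  isMinWeight-⊗ : ∀ {m n} {S : ℤ^ m → Set} {T : ℤ^ n → Set} {d₁ d₂} →
    S Respects _≗_ → T Respects _≗_ → IsMinWeight S d₁ → IsMinWeight T d₂ → IsMinWeight (S ⊗ T) (d₁ ℕ.* d₂)
  isMinWeight-⊗ {S = S} {T} S-resp T-resp mS mT = record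
    { weight-≥          = weight-⊗-≥ {S = S} {T} (weight-≥ mS) (weight-≥ mT)
    ; witness           = witness mS ⊛ witness mT
    ; witness-supported = ⊛-supported S-resp T-resp (witness mS) (witness mT)
                            (witness-supported mS) (witness-supported mT)
    ; witness-nonzero   = ⊛-nonzero (witness mS) (witness mT) (witness-nonzero mS) (witness-nonzero mT)
    ; witness-weight    = ≡.trans (weight-⊛ (witness mS) (witness mT))
                            (cong₂ ℕ._*_ (witness-weight mS) (witness-weight mT))
    }
    where open IsMinWeight

  eval-nullary : ∀ (f : LaurentPoly 0) t v → eval f t ≈ coeff f v
  eval-nullary []            t v = ≈-refl
  eval-nullary ((a , u) ∷ f) t v with u ≟ᵛ v
  ... | yes _   = +-cong (*-identityʳ a) (eval-nullary f t v)
  ... | no  u≉v = ⊥-elim (u≉v λ ())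

  isMinWeight-⊤ : IsMinWeight {0} (λ _ → ⊤) 1
  isMinWeight-⊤ = record
    { weight-≥          = λ f _ f≢0 → ℕP.≤-reflexive (≡.sym (weight≡1 f f≢0))
    ; witness           = 1ₚ
    ; witness-supported = tt ∷ []
    ; witness-nonzero   = 1ₚ≢0
    ; witness-weight    = weight≡1 1ₚ 1ₚ≢0
    }
    where
    weight≡1 : ∀ f → NonZeroPoly f → weight f ≡ 1
    weight≡1 f (v , f[v]≉0) =
      cong (ℕ._+ 0) (wt-≉0 λ f[]≈0 → f[v]≉0 (≈-trans (≈-sym (eval-nullary f (λ ()) v)) f[]≈0))
    1ₚ : LaurentPoly 0
    1ₚ = (1# , λ ()) ∷ []
    1ₚ≢0 : NonZeroPoly 1ₚ
    1ₚ≢0 = (λ ()) , λ 1ₚ[]≈0 → 1≉0 (begin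
      1#                    ≈⟨ *-identityʳ 1# ⟨
      1# * 1#               ≈⟨ +-identityʳ _ ⟨
      eval 1ₚ (λ ())        ≈⟨ eval-nullary 1ₚ (λ ()) (λ ()) ⟩
      coeff 1ₚ (λ ())       ≈⟨ 1ₚ[]≈0 ⟩
      0#                    ∎)
      where open ≈-Reasoning

  isMinWeight-⨂ : ∀ r ms S (ds : Fin r → ℕ) → (∀ k → S k Respects _≗_) →
    (∀ k → IsMinWeight (S k) (ds k)) → IsMinWeight (⨂ r ms S) (product (tabulate ds))
  isMinWeight-⨂ zero    ms S ds S-resp mS = isMinWeight-⊤
  isMinWeight-⨂ (suc r) ms S ds S-resp mS = isMinWeight-⊗ (S-resp zero)
    (⨂-respects r (ms ∘ suc) (S ∘ suc) (S-resp ∘ suc))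
    (mS zero) (isMinWeight-⨂ r (ms ∘ suc) (S ∘ suc) (ds ∘ suc) (S-resp ∘ suc) (mS ∘ suc))

module Renaming {c ℓ} (F : FiniteField c ℓ) where

  open FiniteField F hiding (zero)
    renaming (refl to ≈-refl; sym to ≈-sym; trans to ≈-trans)
  open Toric F
  open ListSums
  open TorusSums F
  open Polynomials F
  open Weight F
  open import Data.Nat using (_≤_)
  open import Data.Fin.Permutation as Perm using (Permutation; _⟨$⟩ʳ_; _⟨$⟩ˡ_)

  module _ {m n : ℕ} (π : Permutation m n) where

    rename : LaurentPoly m → LaurentPoly n
    rename = map (λ (a , u) → a , u ∘ (π ⟨$⟩ˡ_))

    eval-rename : ∀ f t → eval (rename f) t ≈ eval f (t ∘ (π ⟨$⟩ʳ_))
    eval-rename []            t = ≈-refl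
    eval-rename ((a , u) ∷ f) t = +-cong (*-congˡ (monomial-permute π u t)) (eval-rename f t)

    weight-rename : ∀ f → weight (rename f) ≡ weight f
    weight-rename f = ≡.sym (≡.trans (∑-torus-permute m n π _ (wt∘eval-cong f))
      (∑-cong (torus n) λ t → wt-cong (≈-sym (eval-rename f t))))

    coeff-rename : ∀ f v → coeff (rename f) v ≡ coeff f (v ∘ (π ⟨$⟩ʳ_))
    coeff-rename []            v = refl
    coeff-rename ((a , u) ∷ f) v with (u ∘ (π ⟨$⟩ˡ_)) ≟ᵛ v | u ≟ᵛ (v ∘ (π ⟨$⟩ʳ_))
    ... | yes _   | yes _   = cong (a +_) (coeff-rename f v)
    ... | no  _   | no  _   = coeff-rename f v
    ... | yes uπ≗v | no u≉vπ = ⊥-elim (u≉vπ λ i → ≡.trans (cong u (≡.sym (Perm.inverseˡ π))) (uπ≗v _))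
    ... | no uπ≉v | yes u≗vπ = ⊥-elim (uπ≉v λ j → ≡.trans (u≗vπ _) (cong v (Perm.inverseʳ π)))

    rename-nonzero : ∀ f → NonZeroPoly f → NonZeroPoly (rename f)
    rename-nonzero f (v , f[v]≉0) = v ∘ (π ⟨$⟩ˡ_) , λ f′[vπ]≈0 → f[v]≉0 (≈-trans
      (reflexive (≡.trans (coeff-cong f (λ i → cong v (≡.sym (Perm.inverseˡ π)))) (≡.sym (coeff-rename f _))))
      f′[vπ]≈0)

    rename-supported : ∀ {E : ℤ^ m → Set} {E′ : ℤ^ n → Set} → (∀ u → E u → E′ (u ∘ (π ⟨$⟩ˡ_))) →
      ∀ f → Supported E f → Supported E′ (rename f)
    rename-supported E⇒E′ []            []            = []
    rename-supported E⇒E′ ((a , u) ∷ f) (u∈E ∷ f∈E) = E⇒E′ u u∈E ∷ rename-supported E⇒E′ f f∈E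

  isMinWeight-rename : ∀ {m n} (π : Permutation m n) {E : ℤ^ m → Set} {E′ : ℤ^ n → Set} {d} →
    (∀ u → E u → E′ (u ∘ (π ⟨$⟩ˡ_))) → (∀ v → E′ v → E (v ∘ (π ⟨$⟩ʳ_))) →
    IsMinWeight E d → IsMinWeight E′ d
  isMinWeight-rename π {E} {E′} E⇒E′ E′⇒E mE = record
    { weight-≥          = λ g g∈E′ g≢0 → ≡.subst (_ ≤_) (weight-rename π⁻¹ g)
        (weight-≥ mE (rename π⁻¹ g) (rename-supported π⁻¹ E′⇒E g g∈E′) (rename-nonzero π⁻¹ g g≢0))
    ; witness           = rename π (witness mE)
    ; witness-supported = rename-supported π E⇒E′ (witness mE) (witness-supported mE)
    ; witness-nonzero   = rename-nonzero π (witness mE) (witness-nonzero mE)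
    ; witness-weight    = ≡.trans (weight-rename π (witness mE)) (witness-weight mE)
    }
    where
    open IsMinWeight
    π⁻¹ = Perm.flip π

module LatticePoints where

  open import Data.Nat using (zero; z≤n; s≤s)
  open import Data.Integer as ℤ using (ℤ; +_; -[1+_])
  open import Data.Rational as ℚ using (ℚ; 0ℚ; 1ℚ; _/_; _≤_)
  open import Data.Rational.Properties
    using ( normalize-coprime; drop-*≤*; <-irrefl; <⇒≤; ≮⇒≥; _<?_; ≤-refl; ≤-reflexive; ≤-trans; ≤-antisym
          ; +-mono-≤; +-mono-≤-<; +-comm; +-assoc; +-identityˡ; +-identityʳ; *-zeroʳ; *-identityˡ; *-identityʳ
          ; <-≤-trans; module ≤-Reasoning )
  open import Data.List.Membership.Propositional using (_∈_)
  open import Data.Nat.Coprimality using (Coprime; 1-coprimeTo)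
  import Data.Nat.Coprimality as Coprime

  coprime-1 : ∀ n → Coprime n 1
  coprime-1 n = Coprime.sym (1-coprimeTo n)

  2+n/1≰1 : ∀ n → ¬ (+ suc (suc n) / 1 ≤ 1ℚ)
  2+n/1≰1 n 2+n≤1 with drop-*≤* (≡.subst (_≤ 1ℚ) (normalize-coprime (coprime-1 (suc (suc n)))) 2+n≤1)
  ... | ℤ.+≤+ (s≤s ())

  0≰-[1+n]/1 : ∀ n → ¬ (0ℚ ≤ -[1+ n ] / 1)
  0≰-[1+n]/1 n 0≤-n with drop-*≤* (≡.subst (0ℚ ≤_) (cong ℚ.-_ (normalize-coprime (coprime-1 (suc n)))) 0≤-n)
  ... | ()

  z/1≡1 : ∀ z → 0ℚ ℚ.< z / 1 → z / 1 ≤ 1ℚ → z / 1 ≡ 1ℚ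
  z/1≡1 (+ zero)          0<0 _   = ⊥-elim (<-irrefl refl 0<0)
  z/1≡1 (+ suc zero)      _   _   = refl
  z/1≡1 (+ suc (suc n))   _   z≤1 = ⊥-elim (2+n/1≰1 n z≤1)
  z/1≡1 -[1+ n ]          0<z _   = ⊥-elim (0≰-[1+n]/1 n (<⇒≤ 0<z))

  z/1≡0 : ∀ z → 0ℚ ≤ z / 1 → z / 1 ℚ.< 1ℚ → z / 1 ≡ 0ℚ
  z/1≡0 (+ zero)          _   _   = refl
  z/1≡0 (+ suc zero)      _   1<1 = ⊥-elim (<-irrefl refl 1<1)
  z/1≡0 (+ suc (suc n))   _   z<1 = ⊥-elim (2+n/1≰1 n (<⇒≤ z<1))
  z/1≡0 -[1+ n ]          0≤z _   = ⊥-elim (0≰-[1+n]/1 n 0≤z)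

  Binary : ∀ {n} → ℚ^ n → Set
  Binary v = ∀ i → v i ≡ 0ℚ ⊎ v i ≡ 1ℚ

  module _ {n : ℕ} where

    BinaryTerm : ℚ × ℚ^ n → Set
    BinaryTerm (α , v) = 0ℚ ≤ α × Binary v

    mass : List (ℚ × ℚ^ n) → ℚ
    mass L = sumℚ (map proj₁ L)

    coord : Fin n → List (ℚ × ℚ^ n) → ℚ
    coord i L = sumℚ (map (λ (α , v) → α ℚ.* v i) L)

    term-nonneg : ∀ {α v} → BinaryTerm (α , v) → ∀ i → 0ℚ ≤ α ℚ.* v i
    term-nonneg {α} (0≤α , v-binary) i with v-binary i
    ... | inj₁ vi≡0 rewrite vi≡0 = ≤-reflexive (≡.sym (*-zeroʳ α))
    ... | inj₂ vi≡1 rewrite vi≡1 = ≤-trans 0≤α (≤-reflexive (≡.sym (*-identityʳ α)))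

    term≤coefficient : ∀ {α v} → BinaryTerm (α , v) → ∀ i → α ℚ.* v i ≤ α
    term≤coefficient {α} (0≤α , v-binary) i with v-binary i
    ... | inj₁ vi≡0 rewrite vi≡0 = ≤-trans (≤-reflexive (*-zeroʳ α)) 0≤α
    ... | inj₂ vi≡1 rewrite vi≡1 = ≤-reflexive (*-identityʳ α)

    coord-nonneg : ∀ i L → All BinaryTerm L → 0ℚ ≤ coord i L
    coord-nonneg i []      []       = ≤-refl
    coord-nonneg i (p ∷ L) (t ∷ ts) = ≤-trans (≤-reflexive (≡.sym (+-identityʳ 0ℚ)))
                                              (+-mono-≤ (term-nonneg t i) (coord-nonneg i L ts))

    coord≤mass : ∀ i L → All BinaryTerm L → coord i L ≤ mass L
    coord≤mass i []      []       = ≤-refl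
    coord≤mass i (p ∷ L) (t ∷ ts) = +-mono-≤ (term≤coefficient t i) (coord≤mass i L ts)

    positive-term : ∀ L → All BinaryTerm L → mass L ≡ 1ℚ → Σ (ℚ × ℚ^ n) λ p → p ∈ L × 0ℚ ℚ.< proj₁ p
    positive-term []      []       ()
    positive-term (p ∷ L) (t ∷ ts) mass≡1 with 0ℚ <? proj₁ p
    ... | yes 0<α = p , here refl , 0<α
    ... | no  0≮α = let (q , q∈L , 0<β) = positive-term L ts mass-tail≡1 in q , there q∈L , 0<β
      where
      α≡0 : proj₁ p ≡ 0ℚ
      α≡0 = ≤-antisym (≮⇒≥ 0≮α) (proj₁ t)
      mass-tail≡1 : mass L ≡ 1ℚ
      mass-tail≡1 = ≡.trans (≡.sym (≡.trans (cong (ℚ._+ mass L) α≡0) (+-identityˡ (mass L)))) mass≡1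

    coefficient≤coord : ∀ i L → All BinaryTerm L → ∀ {p} → p ∈ L → proj₂ p i ≡ 1ℚ → proj₁ p ≤ coord i L
    coefficient≤coord i ((α , v) ∷ L) (t ∷ ts) (here refl) vi≡1 = begin
      α                         ≡⟨ +-identityʳ α ⟨
      α ℚ.+ 0ℚ                  ≡⟨ cong (ℚ._+ 0ℚ) αvi≡α ⟨
      α ℚ.* v i ℚ.+ 0ℚ          ≤⟨ +-mono-≤ (≤-refl {α ℚ.* v i}) (coord-nonneg i L ts) ⟩
      α ℚ.* v i ℚ.+ coord i L   ∎
      where
      open ≤-Reasoning
      αvi≡α = ≡.trans (cong (α ℚ.*_) vi≡1) (*-identityʳ α)
    coefficient≤coord i ((α , v) ∷ L) (t ∷ ts) (there p∈L) vi≡1 = begin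
      _                          ≤⟨ coefficient≤coord i L ts p∈L vi≡1 ⟩
      coord i L                  ≡⟨ +-identityˡ (coord i L) ⟨
      0ℚ ℚ.+ coord i L           ≤⟨ +-mono-≤ (term-nonneg t i) (≤-refl {coord i L}) ⟩
      α ℚ.* v i ℚ.+ coord i L   ∎
      where open ≤-Reasoning

    coord+coefficient≤mass : ∀ i L → All BinaryTerm L → ∀ {p} → p ∈ L → proj₂ p i ≡ 0ℚ →
                             coord i L ℚ.+ proj₁ p ≤ mass L
    coord+coefficient≤mass i ((α , v) ∷ L) (t ∷ ts) (here refl) vi≡0 = begin
      α ℚ.* v i ℚ.+ coord i L ℚ.+ α  ≡⟨ cong (λ x → x ℚ.+ coord i L ℚ.+ α) αvi≡0 ⟩
      0ℚ ℚ.+ coord i L ℚ.+ α         ≡⟨ cong (ℚ._+ α) (+-identityˡ (coord i L)) ⟩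
      coord i L ℚ.+ α                ≡⟨ +-comm (coord i L) α ⟩
      α ℚ.+ coord i L                ≤⟨ +-mono-≤ (≤-refl {α}) (coord≤mass i L ts) ⟩
      α ℚ.+ mass L                   ∎
      where
      open ≤-Reasoning
      αvi≡0 = ≡.trans (cong (α ℚ.*_) vi≡0) (*-zeroʳ α)
    coord+coefficient≤mass i ((α , v) ∷ L) (t ∷ ts) {p} (there p∈L) vi≡0 = begin
      α ℚ.* v i ℚ.+ coord i L ℚ.+ proj₁ p
        ≡⟨ +-assoc (α ℚ.* v i) (coord i L) (proj₁ p) ⟩
      α ℚ.* v i ℚ.+ (coord i L ℚ.+ proj₁ p)
        ≤⟨ +-mono-≤ (term≤coefficient t i) (coord+coefficient≤mass i L ts p∈L vi≡0) ⟩
      α ℚ.+ mass L ∎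
      where open ≤-Reasoning

  latticePoint-binary : ∀ {n} {S : ℚ^ n → Set} → (∀ {v} → S v → Binary v) →
    ∀ {u} → LatticePoint S u → Σ (ℚ^ n) λ v → S v × (∀ i → toℚ^ u i ≡ v i)
  latticePoint-binary {n} {S} S-binary {u} (L , L-terms , mass≡1 , coord≡u) = point (positive-term L terms mass≡1)
    where
    terms : All BinaryTerm L
    terms = All.map (λ (0≤α , v∈S) → 0≤α , S-binary v∈S) L-terms

    -- A generator v with coefficient α > 0 equals u: where v i = 1 the coordinate u i is ≥ α > 0,
    -- where v i = 0 it is ≤ 1 - α < 1, and u i is an integer in [0, 1].
    point : Σ (ℚ × ℚ^ n) (λ p → p ∈ L × 0ℚ ℚ.< proj₁ p) → Σ (ℚ^ n) λ v → S v × (∀ i → toℚ^ u i ≡ v i)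
    point ((α , v) , p∈L , 0<α) = v , v∈S , u≗v
      where
      v∈S = proj₂ (All.lookup L-terms p∈L)
      u≗v : ∀ i → toℚ^ u i ≡ v i
      u≗v i with S-binary v∈S i
      ... | inj₂ vi≡1 = ≡.trans (z/1≡1 (u i) 0<u u≤1) (≡.sym vi≡1)
        where
        0<u = <-≤-trans 0<α (≤-trans (coefficient≤coord i L terms p∈L vi≡1) (≤-reflexive (coord≡u i)))
        u≤1 = ≤-trans (≤-reflexive (≡.sym (coord≡u i))) (≤-trans (coord≤mass i L terms) (≤-reflexive mass≡1))
      ... | inj₁ vi≡0 = ≡.trans (z/1≡0 (u i) 0≤u u<1) (≡.sym vi≡0)
        where
        0≤u = ≤-trans (coord-nonneg i L terms) (≤-reflexive (coord≡u i))
        u<1 = begin-strict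
          toℚ^ u i              ≡⟨ coord≡u i ⟨
          coord i L             ≡⟨ +-identityʳ (coord i L) ⟨
          coord i L ℚ.+ 0ℚ      <⟨ +-mono-≤-< (≤-refl {coord i L}) 0<α ⟩
          coord i L ℚ.+ α      ≤⟨ coord+coefficient≤mass i L terms p∈L vi≡0 ⟩
          mass L                ≡⟨ mass≡1 ⟩
          1ℚ                    ∎
          where open ≤-Reasoning

  point⇒latticePoint : ∀ {n} {S : ℚ^ n → Set} {u v} → S v → (∀ i → toℚ^ u i ≡ v i) → LatticePoint S u
  point⇒latticePoint {v = v} v∈S u≗v =
    (1ℚ , v) ∷ [] , (ℚ.*≤* (ℤ.+≤+ z≤n) , v∈S) ∷ [] , +-identityʳ 1ℚ ,
    λ i → ≡.trans (+-identityʳ _) (≡.trans (*-identityˡ (v i)) (≡.sym (u≗v i)))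

  latticePoint-respects : ∀ {n} (S : ℚ^ n → Set) → LatticePoint S Respects _≗_
  latticePoint-respects S u≗u′ (L , terms , mass≡1 , coord≡u) =
    L , terms , mass≡1 , λ i → ≡.trans (coord≡u i) (cong (_/ 1) (u≗u′ i))

module OrderPolytopes where

  open LatticePoints
  open Blocks using (inject; locate; locate-inject)
  open ExponentSets using (⨂; ⨂⇒blockwise; blockwise⇒⨂)
  open import Data.Rational using (_/_)
  open import Data.Fin.Subset using (Subset; _∈_)
  open import Data.Fin.Subset.Properties using (_∈?_)
  open import Data.Vec using (lookup) renaming (tabulate to tabulateᵛ)
  open import Data.Vec.Properties using ([]=⇒lookup; lookup⇒[]=; lookup∘tabulate)
  open import Function.Bundles using (Inverse; Equivalence)

  indicator-binary : ∀ {m} (P : FinPoset m) I → Binary (indicator P I)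
  indicator-binary P I i with i ∈? I
  ... | yes _ = inj₂ refl
  ... | no  _ = inj₁ refl

  generator-binary : ∀ {m} (P : FinPoset m) {v} → OrderPolytopeGenerators P v → Binary v
  generator-binary P (I , _ , v≗I) i rewrite v≗I i = indicator-binary P I i

  indicator-cong : ∀ {m n} (P : FinPoset m) (Q : FinPoset n) {I J x y} →
    (x ∈ I → y ∈ J) → (y ∈ J → x ∈ I) → indicator P I x ≡ indicator Q J y
  indicator-cong P Q {I} {J} {x} {y} x∈I⇒y∈J y∈J⇒x∈I with x ∈? I | y ∈? J
  ... | yes _   | yes _   = refl
  ... | no  _   | no  _   = refl
  ... | yes x∈I | no  y∉J = ⊥-elim (y∉J (x∈I⇒y∈J x∈I))
  ... | no  x∉I | yes y∈J = ⊥-elim (x∉I (y∈J⇒x∈I y∈J))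

  IdealPoint : ∀ {m} → FinPoset m → ℤ^ m → Set
  IdealPoint {m} P u = Σ (Subset m) λ I → IsUpperIdeal P I × (∀ i → toℚ^ u i ≡ indicator P I i)

  latticePoint⇒idealPoint : ∀ {m} (P : FinPoset m) {u} → LatticePoint (OrderPolytopeGenerators P) u → IdealPoint P u
  latticePoint⇒idealPoint P {u} u∈O with latticePoint-binary (generator-binary P) {u} u∈O
  ... | v , (I , I-upper , v≗I) , u≗v = I , I-upper , λ i → ≡.trans (u≗v i) (v≗I i)

  idealPoint⇒latticePoint : ∀ {m} (P : FinPoset m) {u} → IdealPoint P u → LatticePoint (OrderPolytopeGenerators P) u
  idealPoint⇒latticePoint P {u} (I , I-upper , u≗I) = point⇒latticePoint {u = u} (I , I-upper , λ _ → refl) u≗I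

  reindex : ∀ {m} {n : Fin m → ℕ} → ((x : Fin m) → Subset (n x)) → ((x : Fin m) → Fin (n x)) → Subset m
  reindex I f = tabulateᵛ λ x → lookup (I x) (f x)

  module _ {m} {n : Fin m → ℕ} (I : (x : Fin m) → Subset (n x)) (f : (x : Fin m) → Fin (n x)) where

    ∈-reindex⁺ : ∀ x → f x ∈ I x → x ∈ reindex I f
    ∈-reindex⁺ x fx∈Ix = lookup⇒[]= x _ (≡.trans (lookup∘tabulate _ x) ([]=⇒lookup fx∈Ix))

    ∈-reindex⁻ : ∀ x → x ∈ reindex I f → f x ∈ I x
    ∈-reindex⁻ x x∈I = lookup⇒[]= (f x) (I x) (≡.trans (≡.sym (lookup∘tabulate _ x)) ([]=⇒lookup x∈I))

  module Decomposition {m r} {ms : Fin r → ℕ} {Q : (k : Fin r) → FinPoset (ms k)} {P : FinPoset m}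
                       (D : ComponentDecomposition Q P) where

    open ComponentDecomposition D
    open FinPoset using (_≼_)

    to : Fin m → Σ (Fin r) (Fin ∘ ms)
    to = Inverse.to iso

    from : Σ (Fin r) (Fin ∘ ms) → Fin m
    from = Inverse.from iso

    from-≼ : ∀ k {a b} → _≼_ (Q k) a b → _≼_ P (from (k , a)) (from (k , b))
    from-≼ k a≼b = Equivalence.from (order _ _)
      (≡.subst₂ (_≼⊎_ Q) (≡.sym (Inverse.strictlyInverseˡ iso _)) (≡.sym (Inverse.strictlyInverseˡ iso _)) (inj a≼b))

    restrict-idealPoint : ∀ k {u} → IdealPoint P u → IdealPoint (Q k) (u ∘ from ∘ (k ,_))
    restrict-idealPoint k (I , I-upper , u≗I) = Iₖ , Iₖ-upper , λ a →
      ≡.trans (u≗I _) (indicator-cong P (Q k) (∈-reindex⁺ (λ _ → I) _ a) (∈-reindex⁻ (λ _ → I) _ a))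
      where
      Iₖ = reindex (λ _ → I) (from ∘ (k ,_))
      Iₖ-upper : IsUpperIdeal (Q k) Iₖ
      Iₖ-upper b a a∈Iₖ a≼b =
        ∈-reindex⁺ (λ _ → I) _ b (I-upper _ _ (∈-reindex⁻ (λ _ → I) _ a a∈Iₖ) (from-≼ k a≼b))

    glue-idealPoint : ∀ {u} → (∀ k → IdealPoint (Q k) (u ∘ from ∘ (k ,_))) → IdealPoint P u
    glue-idealPoint {u} ideals = I , I-upper , u≗I
      where
      J : (k : Fin r) → Subset (ms k)
      J k = proj₁ (ideals k)
      I = reindex (J ∘ proj₁ ∘ to) (proj₂ ∘ to)
      ∈I⁺ = ∈-reindex⁺ (J ∘ proj₁ ∘ to) (proj₂ ∘ to)
      ∈I⁻ = ∈-reindex⁻ (J ∘ proj₁ ∘ to) (proj₂ ∘ to)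
      step : ∀ p q → _≼⊎_ Q p q → proj₂ p ∈ J (proj₁ p) → proj₂ q ∈ J (proj₁ q)
      step (k , a) (.k , b) (inj a≼b) a∈J = proj₁ (proj₂ (ideals k)) b a a∈J a≼b
      I-upper : IsUpperIdeal P I
      I-upper x y y∈I y≼x = ∈I⁺ x (step (to y) (to x) (Equivalence.to (order y x) y≼x) (∈I⁻ y y∈I))
      u≗I : ∀ x → toℚ^ u x ≡ indicator P I x
      u≗I x = let (k , a) = to x in begin
        u x / 1                             ≡⟨ cong (λ y → u y / 1) (Inverse.strictlyInverseʳ iso x) ⟨
        u (from (k , a)) / 1                ≡⟨ proj₂ (proj₂ (ideals k)) a ⟩
        indicator (Q k) (J k) a             ≡⟨ indicator-cong (Q k) P (∈I⁺ x) (∈I⁻ x) ⟩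
        indicator P I x                     ∎
        where open ≡.≡-Reasoning

    latticePoint⇒⨂ : ∀ u → LatticePoint (OrderPolytopeGenerators P) u →
      ⨂ r ms (λ k → LatticePoint (OrderPolytopeGenerators (Q k))) (u ∘ from ∘ locate r ms)
    latticePoint⇒⨂ u u∈O = blockwise⇒⨂ r ms _ _ λ k →
      latticePoint-respects _ {u ∘ from ∘ (k ,_)} (λ a → cong (u ∘ from) (≡.sym (locate-inject r ms (k , a))))
        (idealPoint⇒latticePoint (Q k) {u ∘ from ∘ (k ,_)} (restrict-idealPoint k {u} u-ideal))
      where
      u-ideal = latticePoint⇒idealPoint P {u} u∈O

    ⨂⇒latticePoint : ∀ w → ⨂ r ms (λ k → LatticePoint (OrderPolytopeGenerators (Q k))) w →
      LatticePoint (OrderPolytopeGenerators P) (w ∘ inject r ms ∘ to)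
    ⨂⇒latticePoint w w∈⨂ = idealPoint⇒latticePoint P {u} (glue-idealPoint {u} block-ideal)
      where
      u = w ∘ inject r ms ∘ to
      block-ideal : ∀ k → IdealPoint (Q k) (u ∘ from ∘ (k ,_))
      block-ideal k = latticePoint⇒idealPoint (Q k) {u ∘ from ∘ (k ,_)}
        (latticePoint-respects _ {w ∘ inject r ms ∘ (k ,_)}
          (λ a → cong (w ∘ inject r ms) (≡.sym (Inverse.strictlyInverseˡ iso (k , a))))
          (⨂⇒blockwise r ms _ w w∈⨂ k))

open Weight using (IsMinWeight; isMinWeight-unique; minDistance⇒isMinWeight)
open Products using (isMinWeight-⨂)
open Renaming using (isMinWeight-rename)
open LatticePoints using (latticePoint-respects)
open Blocks using (blocks)
open ExponentSets using (⨂)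

proposition4p1 : ∀ {c ℓ} (F : FiniteField c ℓ) →
    2 < FiniteField.size F →
    Σ ℕ (λ p → Σ ℕ (λ k → Prime p × FiniteField.size F ≡ p ^ suc k)) →
    ∀ {m} (P : FinPoset m) (r : ℕ) (ms : Fin r → ℕ)
    (Q : (i : Fin r) → FinPoset (ms i)) →
    ComponentDecomposition Q P →
    ∀ (d : ℕ) (ds : Fin r → ℕ) →
    Toric.MinDistance F (OrderPolytopeGenerators P) d →
    (∀ i → Toric.MinDistance F (OrderPolytopeGenerators (Q i)) (ds i)) →
    d ≡ product (tabulate ds)
proposition4p1 F _ _ P r ms Q D d ds d-minimal ds-minimal =
  isMinWeight-unique F (minDistance⇒isMinWeight F d-minimal) P-minimal
  where
  open ComponentDecomposition D using (iso)
  open OrderPolytopes.Decomposition D using (latticePoint⇒⨂; ⨂⇒latticePoint)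

  ⨂-minimal : IsMinWeight F (⨂ r ms (λ k → LatticePoint (OrderPolytopeGenerators (Q k)))) (product (tabulate ds))
  ⨂-minimal = isMinWeight-⨂ F r ms _ ds (λ _ → latticePoint-respects _) (minDistance⇒isMinWeight F ∘ ds-minimal)

  P-minimal : IsMinWeight F (LatticePoint (OrderPolytopeGenerators P)) (product (tabulate ds))
  P-minimal = isMinWeight-rename F (↔-trans (blocks r ms) (↔-sym iso)) ⨂⇒latticePoint latticePoint⇒⨂ ⨂-minimal
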